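{- Let $\epsilon<1/6$ and let $k,m$ be positive integers with $m-k\ge2$. Suppose $s$ is an $(\epsilon,k,m)^*$-normal binary string. Then each of $s+1$ and $s+2$, interpreted as binary strings of the same length as $s$, can be written as the concatenation of an $(\epsilon,k,m)$-normal string followed by a string of length at most $m+2$.
   Context: A binary string $s$ is identified with the integer it represents in base $2$; $s+1$, $s+2$ are the binary representations, padded to length $|s|$, of that integer plus $1$, $2$. For a binary string $w$, $\nu_u(w)$ counts occurrences of $u$ as a contiguous substring; $w$ is $(\epsilon,u)$-normal if $|w|\ge|u|$ and $\left|\frac{\nu_u(w)}{|w|-|u|+1}-2^{ -|u|}\right|\le\epsilon$; $(\epsilon,k)$-normal if $(\epsilon,u)$-normal for all $u$ of length $k$; $(\epsilon,k,m)$-normal if every prefix of $w$ of length a positive multiple of $m$ is $(\epsilon,k)$-normal; $(\epsilon,k,m)^*$-normal if both $w$ and its reversal are $(\epsilon,k,m)$-normal.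
   Formalization: The parameter ε ranges over the rationals. -}

module Defs where

open import Data.Bool using (Bool; true; false; if_then_else_)
open import Data.Nat using (ℕ; zero; suc; _+_; _*_; _∸_; _^_; _≤_; _<_; _≡ᵇ_)
open import Data.Nat.DivMod using (_%_; _/_)
open import Data.List using (List; []; _∷_; length; take; drop; reverse; _++_)
open import Data.Integer using (+_)
open import Data.Rational using (ℚ; ∣_∣; _-_) renaming (_≤_ to _≤ℚ_; _/_ to _/ℚ_)
open import Data.Product using (_×_; Σ)
open import Data.Nat.Properties using (m^n≢0)
open import Relation.Binary.PropositionalEquality using (_≡_)

-- Binary strings: lists of bits, most significant bit first (true = 1).
BinStr : Set
BinStr = List Bool

bit : Bool → ℕ
bit true  = 1
bit false = 0

valAcc : ℕ → BinStr → ℕ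
valAcc acc []       = acc
valAcc acc (b ∷ bs) = valAcc (2 * acc + bit b) bs

val : BinStr → ℕ
val = valAcc 0

-- Binary representation of n padded/truncated to exactly len bits (MSB first),
-- i.e. of n mod 2^len.
toBin : (len : ℕ) → ℕ → BinStr
toBin zero    n = []
toBin (suc l) n = ((_/_ n (2 ^ l) {{m^n≢0 2 l}}) % 2 ≡ᵇ 1) ∷ toBin l n

addStr : BinStr → ℕ → BinStr
addStr s j = toBin (length s) (val s + j)

isPrefix : BinStr → BinStr → Bool
isPrefix []       _        = true
isPrefix (_ ∷ _)  []       = false
isPrefix (a ∷ as) (b ∷ bs) = if eqB a b then isPrefix as bs else false
  where
  eqB : Bool → Bool → Bool
  eqB true  true  = true
  eqB false false = true
  eqB _     _     = false

-- ν_u(w): number of occurrences of u as a contiguous substring of w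
-- (overlapping occurrences counted).
occ : BinStr → BinStr → ℕ
occ u []           = if isPrefix u [] then 1 else 0
occ u w@(_ ∷ rest) = (if isPrefix u w then 1 else 0) + occ u rest

EpsNormalU : ℚ → BinStr → BinStr → Set
EpsNormalU ε u w =
  (length u ≤ length w) ×
  (∣ (+ occ u w /ℚ suc (length w ∸ length u))
     - ((+ 1 /ℚ (2 ^ length u)) {{m^n≢0 2 (length u)}}) ∣ ≤ℚ ε)

EpsNormalK : ℚ → ℕ → BinStr → Set
EpsNormalK ε k w = ∀ (u : BinStr) → length u ≡ k → EpsNormalU ε u w

EpsNormalKM : ℚ → ℕ → ℕ → BinStr → Set
EpsNormalKM ε k m w =
  ∀ (j : ℕ) → 1 ≤ j → j * m ≤ length w → EpsNormalK ε k (take (j * m) w)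

EpsNormalKM* : ℚ → ℕ → ℕ → BinStr → Set
EpsNormalKM* ε k m w = EpsNormalKM ε k m w × EpsNormalKM ε k m (reverse w)

NormalThenShort : ℚ → ℕ → ℕ → BinStr → Set
NormalThenShort ε k m t =
  Σ BinStr λ x → Σ BinStr λ y →
    (t ≡ x ++ y) × EpsNormalKM ε k m x × (length y ≤ m + 2)

{-# OPTIONS --safe #-}
-- Let B be the last m bits of s. The reversal of s begins with the reversal of B, so that block
-- is (ε,k)-normal. If all of B except its final bit were 1, the word 1ᵏ would occur in it with
-- frequency at least (m − k)/(m − k + 1) ≥ 2/3, which is more than 1/6 away from 2⁻ᵏ ≤ 1/2.
-- Hence B contains a 0 before its final bit. Writing s = p ++ 0 ∷ zs with zs nonempty and
-- |0 ∷ zs| ≤ m, adding 1 or 2 to s does not carry past that 0, so s + j = p ++ ((0 ∷ zs) + j),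
-- and p, being a prefix of s, is (ε,k,m)-normal.
module Submission where

open import Defs
open import Data.Bool using (true; false)
open import Data.Empty using (⊥-elim)
open import Data.Integer using (+_)
import Data.Integer as ℤ
import Data.Integer.Properties as ℤP
open import Data.List using (List; []; _∷_; length; take; drop; reverse; _++_; _∷ʳ_; [_]; replicate; initLast; _∷ʳ′_)
open import Data.List.Properties using (length-++; length-drop; length-reverse; length-replicate; reverse-++; take-all; take++drop≡id; ++-assoc; unfold-reverse)
open import Data.List.Relation.Unary.All using (All; []; _∷_)
open import Data.List.Relation.Unary.All.Properties using (++⁺; replicate⁺)
open import Data.Nat hiding (∣_-_∣)
open import Data.Nat.DivMod
open import Data.Nat.Divisibility using (n∣m*n)
open import Data.Nat.Properties
open import Data.Product using (_×_; _,_; ∃₂)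
open import Data.Rational using (ℚ; ∣_∣; _-_; toℚᵘ) renaming (_<_ to _<ℚ_; _≤_ to _≤ℚ_; _/_ to _/ℚ_)
import Data.Rational.Properties as ℚP
import Data.Rational.Unnormalised as ℚᵘ
import Data.Rational.Unnormalised.Properties as ℚᵘP
open import Data.Sum using (_⊎_; inj₁; inj₂)
open import Relation.Nullary using (¬_; Dec; yes; no)
open import Relation.Binary.PropositionalEquality hiding ([_])

fraction-mono-≤ : ∀ {m₁ n₁ m₂ n₂} → m₁ * suc n₂ ≤ m₂ * suc n₁ → + m₁ /ℚ suc n₁ ≤ℚ + m₂ /ℚ suc n₂
fraction-mono-≤ {m₁} {n₁} {m₂} {n₂} le =
  ℚP.toℚᵘ-cancel-≤ (ℚᵘP.≤-respˡ-≃ (mkℚᵘ≃toℚᵘ m₁ n₁) (ℚᵘP.≤-respʳ-≃ (mkℚᵘ≃toℚᵘ m₂ n₂)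
    (ℚᵘ.*≤* (subst₂ ℤ._≤_ (ℤP.pos-* m₁ (suc n₂)) (ℤP.pos-* m₂ (suc n₁)) (ℤ.+≤+ le)))))
  where
  mkℚᵘ≃toℚᵘ : ∀ m n → ℚᵘ.mkℚᵘ (+ m) n ℚᵘ.≃ toℚᵘ (+ m /ℚ suc n)
  mkℚᵘ≃toℚᵘ m n = ℚᵘP.≃-sym (ℚP.toℚᵘ-fromℚᵘ (ℚᵘ.mkℚᵘ (+ m) n))

⅙≤∣c/[1+a]-1/d∣ : ∀ {a c d} .{{_ : NonZero d}} → 2 ≤ a → a ≤ c → 2 ≤ d →
  + 1 /ℚ 6 ≤ℚ ∣ + c /ℚ suc a - + 1 /ℚ d ∣
⅙≤∣c/[1+a]-1/d∣ {a} {c} {suc d} 2≤a a≤c 2≤d =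
  subst (+ 1 /ℚ 6 ≤ℚ_) (sym (ℚP.0≤p⇒∣p∣≡p (ℚP.≤-trans (ℚP.≤ᵇ⇒≤ _) ⅙≤gap))) ⅙≤gap
  where
  ⅔≤c/[1+a] : + 2 /ℚ 3 ≤ℚ + c /ℚ suc a
  ⅔≤c/[1+a] = fraction-mono-≤ {2} {2} {c} {a} (begin
    2 * suc a  ≡⟨ *-comm 2 (suc a) ⟩
    2 + a * 2  ≤⟨ +-monoˡ-≤ (a * 2) 2≤a ⟩
    a + a * 2  ≡⟨ *-suc a 2 ⟨
    a * 3      ≤⟨ *-monoˡ-≤ 3 a≤c ⟩
    c * 3      ∎)
    where open ≤-Reasoning
  1/d≤½ : + 1 /ℚ suc d ≤ℚ + 1 /ℚ 2
  1/d≤½ = fraction-mono-≤ {1} {d} {1} {1} (*-monoʳ-≤ 1 2≤d)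
  ⅙≤gap : + 1 /ℚ 6 ≤ℚ + c /ℚ suc a - + 1 /ℚ suc d
  ⅙≤gap = ℚP.+-mono-≤ ⅔≤c/[1+a] (ℚP.neg-antimono-≤ 1/d≤½)

take-++ˡ : ∀ {A : Set} (xs : List A) {ys : List A} {n} → n ≤ length xs → take n (xs ++ ys) ≡ take n xs
take-++ˡ _        {n = zero}  _          = refl
take-++ˡ (x ∷ xs) {n = suc n} (s≤s n≤xs) = cong (x ∷_) (take-++ˡ xs n≤xs)

suffix-of-length : ∀ {A : Set} (xs : List A) {n} → n ≤ length xs →
  ∃₂ λ ys zs → xs ≡ ys ++ zs × length zs ≡ n
suffix-of-length xs {n} n≤xs =
  take (length xs ∸ n) xs , drop (length xs ∸ n) xs ,
  sym (take++drop≡id (length xs ∸ n) xs) , trans (length-drop (length xs ∸ n) xs) (m∸[m∸n]≡n n≤xs)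

reverse-∷ʳ : ∀ {A : Set} (xs : List A) x → reverse (xs ∷ʳ x) ≡ x ∷ reverse xs
reverse-∷ʳ xs x = reverse-++ xs [ x ]

All-reverse : ∀ {A : Set} {P : A → Set} {xs} → All P xs → All P (reverse xs)
All-reverse []                      = []
All-reverse {xs = x ∷ xs} (px ∷ pxs) = subst (All _) (sym (unfold-reverse x xs)) (++⁺ (All-reverse pxs) (px ∷ []))

all-true-or-has-false : ∀ bs → All (_≡ true) bs ⊎ ∃₂ λ xs ys → bs ≡ xs ++ false ∷ ys
all-true-or-has-false []           = inj₁ []
all-true-or-has-false (false ∷ bs) = inj₂ ([] , bs , refl)
all-true-or-has-false (true ∷ bs) with all-true-or-has-false bs
... | inj₁ ones           = inj₁ (refl ∷ ones)
... | inj₂ (xs , ys , eq) = inj₂ (true ∷ xs , ys , cong (true ∷_) eq)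

length-toBin : ∀ n N → length (toBin n N) ≡ n
length-toBin zero    N = refl
length-toBin (suc n) N = cong suc (length-toBin n N)

length-addStr : ∀ s j → length (addStr s j) ≡ length s
length-addStr s j = length-toBin (length s) (val s + j)

valAcc-++ : ∀ acc p q → valAcc acc (p ++ q) ≡ valAcc (valAcc acc p) q
valAcc-++ acc []      q = refl
valAcc-++ acc (b ∷ p) q = valAcc-++ (2 * acc + bit b) p q

valAcc≡acc*2^length+val : ∀ acc q → valAcc acc q ≡ acc * 2 ^ length q + val q
valAcc≡acc*2^length+val acc []      = sym (trans (+-identityʳ _) (*-identityʳ acc))
valAcc≡acc*2^length+val acc (b ∷ q) = begin
  valAcc (2 * acc + bit b) q           ≡⟨ valAcc≡acc*2^length+val (2 * acc + bit b) q ⟩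
  (2 * acc + bit b) * P + val q        ≡⟨ cong (_+ val q) (*-distribʳ-+ P (2 * acc) (bit b)) ⟩
  2 * acc * P + bit b * P + val q      ≡⟨ +-assoc (2 * acc * P) (bit b * P) (val q) ⟩
  2 * acc * P + (bit b * P + val q)    ≡⟨ cong₂ _+_ 2*acc*P≡acc*[2*P] (sym (valAcc≡acc*2^length+val (bit b) q)) ⟩
  acc * (2 * P) + valAcc (bit b) q     ∎
  where
  open ≡-Reasoning
  P = 2 ^ length q
  2*acc*P≡acc*[2*P] : 2 * acc * P ≡ acc * (2 * P)
  2*acc*P≡acc*[2*P] = trans (cong (_* P) (*-comm 2 acc)) (*-assoc acc 2 P)

val-++ : ∀ p q → val (p ++ q) ≡ val p * 2 ^ length q + val q
val-++ p q = trans (valAcc-++ 0 p q) (valAcc≡acc*2^length+val (val p) q)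

bit≤1 : ∀ b → bit b ≤ 1
bit≤1 true  = s≤s z≤n
bit≤1 false = z≤n

val<2^length : ∀ p → val p < 2 ^ length p
val<2^length []      = s≤s z≤n
val<2^length (b ∷ q) = begin-strict
  val ([ b ] ++ q)     ≡⟨ val-++ [ b ] q ⟩
  bit b * P + val q    <⟨ +-monoʳ-< (bit b * P) (val<2^length q) ⟩
  bit b * P + P        ≤⟨ +-monoˡ-≤ P (*-monoˡ-≤ P (bit≤1 b)) ⟩
  1 * P + P            ≡⟨ cong (_+ P) (*-identityˡ P) ⟩
  P + P                ≡⟨ cong (_+_ P) (+-identityʳ P) ⟨
  2 * P                ∎
  where
  open ≤-Reasoning
  P = 2 ^ length q

[m*n+o]/n≡m+o/n : ∀ m o n .{{_ : NonZero n}} → (m * n + o) / n ≡ m + o / n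
[m*n+o]/n≡m+o/n m o n = trans (+-distrib-/-∣ˡ o (n∣m*n m)) (cong (_+ o / n) (m*n/n≡m m n))

[m*n+o]/n≡m : ∀ m {o n} .{{_ : NonZero n}} → o < n → (m * n + o) / n ≡ m
[m*n+o]/n≡m m {o} {n} o<n =
  trans ([m*n+o]/n≡m+o/n m o n) (trans (cong (_+_ m) (m<n⇒m/n≡0 o<n)) (+-identityʳ m))

toBin-periodic : ∀ n c r → toBin n (c * 2 ^ n + r) ≡ toBin n r
toBin-periodic zero    c r = refl
toBin-periodic (suc n) c r = cong₂ _∷_ (cong (_≡ᵇ 1) same-bit) (trans (cong (toBin n) reassoc) (toBin-periodic n (2 * c) r))
  where
  instance
    2^n≢0 : NonZero (2 ^ n)
    2^n≢0 = m^n≢0 2 n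
  open ≡-Reasoning
  P = 2 ^ n
  reassoc : c * (2 * P) + r ≡ 2 * c * P + r
  reassoc = cong (_+ r) (trans (sym (*-assoc c 2 P)) (cong (_* P) (*-comm c 2)))
  same-bit : (c * (2 * P) + r) / P % 2 ≡ r / P % 2
  same-bit = begin
    (c * (2 * P) + r) / P % 2  ≡⟨ cong (λ x → x / P % 2) reassoc ⟩
    (2 * c * P + r) / P % 2    ≡⟨ cong (_% 2) ([m*n+o]/n≡m+o/n (2 * c) r P) ⟩
    (2 * c + r / P) % 2        ≡⟨ cong (_% 2) (+-comm (2 * c) (r / P)) ⟩
    (r / P + 2 * c) % 2        ≡⟨ cong (λ x → (r / P + x) % 2) (*-comm 2 c) ⟩
    (r / P + c * 2) % 2        ≡⟨ [m+kn]%n≡m%n (r / P) c 2 ⟩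
    r / P % 2                  ∎

toBin-+ : ∀ a n N → toBin (a + n) N ≡ toBin a ((N / 2 ^ n) {{m^n≢0 2 n}}) ++ toBin n N
toBin-+ zero    n N = refl
toBin-+ (suc a) n N = cong₂ _∷_ (cong (λ x → x % 2 ≡ᵇ 1) N/2^[a+n]≡N/2^n/2^a) (toBin-+ a n N)
  where
  instance
    2^n≢0 : NonZero (2 ^ n)
    2^n≢0 = m^n≢0 2 n
    2^a≢0 : NonZero (2 ^ a)
    2^a≢0 = m^n≢0 2 a
    2^[a+n]≢0 : NonZero (2 ^ (a + n))
    2^[a+n]≢0 = m^n≢0 2 (a + n)
    2^n*2^a≢0 : NonZero (2 ^ n * 2 ^ a)
    2^n*2^a≢0 = m*n≢0 (2 ^ n) (2 ^ a)
  open ≡-Reasoning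
  N/2^[a+n]≡N/2^n/2^a : N / 2 ^ (a + n) ≡ N / 2 ^ n / 2 ^ a
  N/2^[a+n]≡N/2^n/2^a = begin
    N / 2 ^ (a + n)        ≡⟨ /-congʳ (trans (^-distribˡ-+-* 2 a n) (*-comm (2 ^ a) (2 ^ n))) ⟩
    N / (2 ^ n * 2 ^ a)    ≡⟨ m/n/o≡m/[n*o] N (2 ^ n) (2 ^ a) ⟨
    N / 2 ^ n / 2 ^ a      ∎

bit%2≡ᵇ1 : ∀ b → (bit b % 2 ≡ᵇ 1) ≡ b
bit%2≡ᵇ1 true  = refl
bit%2≡ᵇ1 false = refl

toBin-val : ∀ p → toBin (length p) (val p) ≡ p
toBin-val []      = refl
toBin-val (b ∷ p) = begin
  toBin (suc (length p)) (val ([ b ] ++ p))           ≡⟨ cong (toBin (suc (length p))) (val-++ [ b ] p) ⟩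
  toBin (suc (length p)) (bit b * 2 ^ length p + val p)
    ≡⟨ cong₂ _∷_ leading-bit (trans (toBin-periodic (length p) (bit b) (val p)) (toBin-val p)) ⟩
  b ∷ p                                               ∎
  where
  instance
    2^|p|≢0 : NonZero (2 ^ length p)
    2^|p|≢0 = m^n≢0 2 (length p)
  open ≡-Reasoning
  leading-bit : ((bit b * 2 ^ length p + val p) / 2 ^ length p % 2 ≡ᵇ 1) ≡ b
  leading-bit = trans (cong (λ x → x % 2 ≡ᵇ 1) ([m*n+o]/n≡m (bit b) (val<2^length p))) (bit%2≡ᵇ1 b)

addStr-++ : ∀ p q j → val q + j < 2 ^ length q → addStr (p ++ q) j ≡ p ++ addStr q j
addStr-++ p q j no-carry = begin
  toBin (length (p ++ q)) (val (p ++ q) + j)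
    ≡⟨ cong₂ toBin (length-++ p) (trans (cong (_+ j) (val-++ p q)) (+-assoc (val p * 2 ^ length q) (val q) j)) ⟩
  toBin (length p + length q) N
    ≡⟨ toBin-+ (length p) (length q) N ⟩
  toBin (length p) (N / 2 ^ length q) ++ toBin (length q) N
    ≡⟨ cong₂ _++_ (cong (toBin (length p)) ([m*n+o]/n≡m (val p) no-carry)) (toBin-periodic (length q) (val p) (val q + j)) ⟩
  toBin (length p) (val p) ++ addStr q j
    ≡⟨ cong (_++ addStr q j) (toBin-val p) ⟩
  p ++ addStr q j
    ∎
  where
  instance
    2^|q|≢0 : NonZero (2 ^ length q)
    2^|q|≢0 = m^n≢0 2 (length q)
  open ≡-Reasoning
  N = val p * 2 ^ length q + (val q + j)

val-0∷+j<2^length : ∀ zs {j} → 1 ≤ length zs → j ≤ 2 → val (false ∷ zs) + j < 2 ^ length (false ∷ zs)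
val-0∷+j<2^length zs {j} 1≤zs j≤2 = begin-strict
  val zs + j    ≤⟨ +-monoʳ-≤ (val zs) j≤2 ⟩
  val zs + 2    <⟨ +-monoˡ-< 2 (val<2^length zs) ⟩
  P + 2         ≤⟨ +-monoʳ-≤ P (^-monoʳ-≤ 2 1≤zs) ⟩
  P + P         ≡⟨ cong (_+_ P) (+-identityʳ P) ⟨
  2 * P         ∎
  where
  open ≤-Reasoning
  P = 2 ^ length zs

isPrefix-ones : ∀ {u w} → All (_≡ true) u → All (_≡ true) w → length u ≤ length w → isPrefix u w ≡ true
isPrefix-ones []          _           _         = refl
isPrefix-ones (refl ∷ ou) (refl ∷ ow) (s≤s u≤w) = isPrefix-ones ou ow u≤w

occ-ones : ∀ {u w} → All (_≡ true) u → All (_≡ true) w → length u ≤ length w → suc (length w ∸ length u) ≤ occ u w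
occ-ones {w = []}    [] [] _ = s≤s z≤n
occ-ones {u} {w = x ∷ w} ou ow@(_ ∷ ow′) u≤x∷w rewrite isPrefix-ones ou ow u≤x∷w with length u ≤? length w
... | yes u≤w = s≤s (subst (_≤ occ u w) (sym (+-∸-assoc 1 u≤w)) (occ-ones ou ow′ u≤w))
... | no  u≰w = s≤s (subst (_≤ occ u w) (sym (m≤n⇒m∸n≡0 (≰⇒> u≰w))) z≤n)

¬EpsNormalU-frequent : ∀ {ε u w} → ε <ℚ + 1 /ℚ 6 → 1 ≤ length u →
  2 ≤ length w ∸ length u → length w ∸ length u ≤ occ u w → ¬ EpsNormalU ε u w
¬EpsNormalU-frequent {u = u} ε<⅙ 1≤u 2≤a a≤occ (_ , dist≤ε) =
  ℚP.<-irrefl refl (ℚP.<-≤-trans ε<⅙ (ℚP.≤-trans (⅙≤∣c/[1+a]-1/d∣ {{m^n≢0 2 (length u)}} 2≤a a≤occ (^-monoʳ-≤ 2 1≤u)) dist≤ε))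

¬EpsNormalK-ones : ∀ {ε k b R} → ε <ℚ + 1 /ℚ 6 → 1 ≤ k → suc k ≤ length R → All (_≡ true) R →
  ¬ EpsNormalK ε k (b ∷ R)
¬EpsNormalK-ones {k = k} {b} {R} ε<⅙ 1≤k k<R ones normal =
  ¬EpsNormalU-frequent {u = u} {w = b ∷ R} ε<⅙ (subst (1 ≤_) (sym |u|≡k) 1≤k) 2≤a a≤occ (normal u |u|≡k)
  where
  u = replicate k true
  |u|≡k : length u ≡ k
  |u|≡k = length-replicate k
  u≤R : length u ≤ length R
  u≤R = subst (_≤ length R) (sym |u|≡k) (<⇒≤ k<R)
  2≤a : 2 ≤ suc (length R) ∸ length u
  2≤a = m+n≤o⇒m≤o∸n 2 (subst (λ l → 2 + l ≤ suc (length R)) (sym |u|≡k) (s≤s k<R))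
  a≤occ : suc (length R) ∸ length u ≤ occ u (b ∷ R)
  a≤occ = begin
    suc (length R) ∸ length u  ≡⟨ +-∸-assoc 1 u≤R ⟩
    suc (length R ∸ length u)  ≤⟨ occ-ones (replicate⁺ k refl) ones u≤R ⟩
    occ u R                    ≤⟨ m≤n+m (occ u R) _ ⟩
    occ u (b ∷ R)              ∎
    where open ≤-Reasoning

EpsNormalKM-[] : ∀ {ε k m} → 1 ≤ m → EpsNormalKM ε k m []
EpsNormalKM-[] {m = suc m} _ (suc j) _ ()

EpsNormalKM-++⁻ˡ : ∀ {ε k m} p {q} → EpsNormalKM ε k m (p ++ q) → EpsNormalKM ε k m p
EpsNormalKM-++⁻ˡ {ε} {k} p {q} normal j 1≤j jm≤p =
  subst (EpsNormalK ε k) (take-++ˡ p jm≤p)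
    (normal j 1≤j (≤-trans jm≤p (subst (length p ≤_) (sym (length-++ p)) (m≤m+n (length p) (length q)))))

EpsNormalKM⇒EpsNormalK : ∀ {ε k m w} → length w ≡ m → EpsNormalKM ε k m w → EpsNormalK ε k w
EpsNormalKM⇒EpsNormalK {ε} {k} {m} {w} |w|≡m normal =
  subst (EpsNormalK ε k) (take-all (1 * m) w (≤-reflexive |w|≡1*m)) (normal 1 ≤-refl (≤-reflexive (sym |w|≡1*m)))
  where
  |w|≡1*m : length w ≡ 1 * m
  |w|≡1*m = trans |w|≡m (sym (*-identityˡ m))

normalThenShort-++ : ∀ {ε k m j} p q → EpsNormalKM ε k m (p ++ q) → val q + j < 2 ^ length q →
  length q ≤ m + 2 → NormalThenShort ε k m (addStr (p ++ q) j)
normalThenShort-++ {j = j} p q normal no-carry short =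
  p , addStr q j , addStr-++ p q j no-carry , EpsNormalKM-++⁻ˡ p normal ,
  subst (_≤ _) (sym (length-addStr q j)) short

module _ (ε : ℚ) (ε<⅙ : ε <ℚ + 1 /ℚ 6) (k m : ℕ) (1≤k : 1 ≤ k) (1≤m : 1 ≤ m) (k+2≤m : k + 2 ≤ m) where

  ¬EpsNormalKM-ones-suffix : ∀ A B b → All (_≡ true) B → length (B ∷ʳ b) ≡ m →
    ¬ EpsNormalKM ε k m (reverse (A ++ (B ∷ʳ b)))
  ¬EpsNormalKM-ones-suffix A B b ones |B∷ʳb|≡m normalʳ =
    ¬EpsNormalK-ones ε<⅙ 1≤k k<|rB| (All-reverse ones)
      (EpsNormalKM⇒EpsNormalK |b∷rB|≡m (EpsNormalKM-++⁻ˡ (b ∷ reverse B) (subst (EpsNormalKM ε k m) rev normalʳ)))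
    where
    rev : reverse (A ++ (B ∷ʳ b)) ≡ (b ∷ reverse B) ++ reverse A
    rev = trans (reverse-++ A (B ∷ʳ b)) (cong (_++ reverse A) (reverse-∷ʳ B b))
    |b∷rB|≡m : length (b ∷ reverse B) ≡ m
    |b∷rB|≡m = trans (cong length (sym (reverse-∷ʳ B b))) (trans (length-reverse (B ∷ʳ b)) |B∷ʳb|≡m)
    k<|rB| : suc k ≤ length (reverse B)
    k<|rB| = s≤s⁻¹ (subst₂ _≤_ (+-comm k 2) (sym |b∷rB|≡m) k+2≤m)

  addStr-suffix-normalThenShort : ∀ A B b j → j ≤ 2 → length (B ∷ʳ b) ≡ m →
    EpsNormalKM* ε k m (A ++ (B ∷ʳ b)) → NormalThenShort ε k m (addStr (A ++ (B ∷ʳ b)) j)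
  addStr-suffix-normalThenShort A B b j j≤2 |B∷ʳb|≡m (normal , normalʳ) with all-true-or-has-false B
  ... | inj₁ ones = ⊥-elim (¬EpsNormalKM-ones-suffix A B b ones |B∷ʳb|≡m normalʳ)
  ... | inj₂ (X , Y , refl) =
    subst (λ s → NormalThenShort ε k m (addStr s j)) (sym s≡)
      (normalThenShort-++ {ε} {k} {m} (A ++ X) q (subst (EpsNormalKM ε k m) s≡ normal)
        (val-0∷+j<2^length (Y ∷ʳ b) 1≤|Y∷ʳb| j≤2) |q|≤m+2)
    where
    q = false ∷ (Y ∷ʳ b)
    B∷ʳb≡X++q : (X ++ false ∷ Y) ∷ʳ b ≡ X ++ q
    B∷ʳb≡X++q = ++-assoc X (false ∷ Y) [ b ]
    s≡ : A ++ ((X ++ false ∷ Y) ∷ʳ b) ≡ (A ++ X) ++ q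
    s≡ = trans (cong (A ++_) B∷ʳb≡X++q) (sym (++-assoc A X q))
    1≤|Y∷ʳb| : 1 ≤ length (Y ∷ʳ b)
    1≤|Y∷ʳb| = subst (1 ≤_) (sym (length-++ Y)) (m≤n+m 1 (length Y))
    |q|≤m+2 : length q ≤ m + 2
    |q|≤m+2 = begin
      length q                        ≤⟨ m≤n+m (length q) (length X) ⟩
      length X + length q             ≡⟨ length-++ X ⟨
      length (X ++ q)                 ≡⟨ cong length B∷ʳb≡X++q ⟨
      length ((X ++ false ∷ Y) ∷ʳ b)  ≡⟨ |B∷ʳb|≡m ⟩
      m                               ≤⟨ m≤m+n m 2 ⟩
      m + 2                           ∎
      where open ≤-Reasoning

  addStr-split-normalThenShort : ∀ A B j → j ≤ 2 → length B ≡ m → EpsNormalKM* ε k m (A ++ B) →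
    NormalThenShort ε k m (addStr (A ++ B) j)
  addStr-split-normalThenShort A B j j≤2 |B|≡m normal* with initLast B
  ... | []       = ⊥-elim (<⇒≢ 1≤m |B|≡m)
  ... | B′ ∷ʳ′ b = addStr-suffix-normalThenShort A B′ b j j≤2 |B|≡m normal*

  addStr-normalThenShort : ∀ s j → j ≤ 2 → EpsNormalKM* ε k m s → NormalThenShort ε k m (addStr s j)
  addStr-normalThenShort s j j≤2 normal* = by-length (m ≤? length s)
    where
    by-length : Dec (m ≤ length s) → NormalThenShort ε k m (addStr s j)
    by-length (no s≱m) = [] , addStr s j , refl , EpsNormalKM-[] 1≤m ,
      subst (_≤ m + 2) (sym (length-addStr s j)) (≤-trans (<⇒≤ (≰⇒> s≱m)) (m≤m+n m 2))
    by-length (yes m≤s) with suffix-of-length s m≤s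
    ... | A , B , s≡A++B , |B|≡m =
      subst (λ t → NormalThenShort ε k m (addStr t j)) (sym s≡A++B)
        (addStr-split-normalThenShort A B j j≤2 |B|≡m (subst (EpsNormalKM* ε k m) s≡A++B normal*))

lemma4p8 : (ε : ℚ) → ε <ℚ (+ 1 /ℚ 6) → (k m : ℕ) → 1 ≤ k → 1 ≤ m → k + 2 ≤ m →
    (s : BinStr) → EpsNormalKM* ε k m s →
    NormalThenShort ε k m (addStr s 1) × NormalThenShort ε k m (addStr s 2)
lemma4p8 ε ε<⅙ k m 1≤k 1≤m k+2≤m s normal* =
  addStr-normalThenShort ε ε<⅙ k m 1≤k 1≤m k+2≤m s 1 (s≤s z≤n) normal* ,
  addStr-normalThenShort ε ε<⅙ k m 1≤k 1≤m k+2≤m s 2 ≤-refl normal*
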